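{- There is an arithmetic circuit $\tau(x)$ in one variable and a semi-regressive function $f:\mathbb{N}\to\mathbb{N}$ such that $\tau(\{n\})=\{f(n)\}$ for every $n\in\mathbb{N}$.
   Context: $\mathbb{N}=\{0,1,2,\ldots\}$. For $s,t\subseteq\mathbb{N}$, $s\oplus t=\{m+n\mid m\in s,n\in t\}$ and $s\otimes t=\{mn\mid m\in s,n\in t\}$. An arithmetic circuit is a term built from variables ranging over subsets of $\mathbb{N}$, the constants $\emptyset$, $\mathbb{N}$, $\{n\}$ ($n\in\mathbb{N}$), and the operations $\cup$, $\cap$, complement relative to $\mathbb{N}$, $\oplus$ and $\otimes$; it is evaluated in the obvious way. A function $f:\mathbb{N}\to\mathbb{N}$ is semi-regressive if for every $\ell\ge0$ there is $n\ge0$ with $n+\ell\le f(n)\le 2n-2$. -}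

module Defs where

open import Data.Nat using (ℕ; _+_; _*_; _≤_)
open import Data.Product using (Σ; ∃; _×_; _,_)
open import Data.Sum using (_⊎_)
open import Data.Empty using (⊥)
open import Data.Unit using (⊤)
open import Relation.Nullary using (¬_)
open import Relation.Binary.PropositionalEquality using (_≡_)
open import Function.Bundles using (_⇔_)

SetN : Set₁
SetN = ℕ → Set

_⊕_ : SetN → SetN → SetN
(s ⊕ t) k = Σ ℕ λ m → Σ ℕ λ n → s m × t n × k ≡ m + n

_⊗_ : SetN → SetN → SetN
(s ⊗ t) k = Σ ℕ λ m → Σ ℕ λ n → s m × t n × k ≡ m * n

data Circuit : Set where
  var   : Circuit
  empty : Circuit
  nat   : Circuit
  sing  : ℕ → Circuit
  _∪c_  : Circuit → Circuit → Circuit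
  _∩c_  : Circuit → Circuit → Circuit
  compl : Circuit → Circuit
  _⊕c_  : Circuit → Circuit → Circuit
  _⊗c_  : Circuit → Circuit → Circuit

eval : Circuit → SetN → SetN
eval var       X k = X k
eval empty     X k = ⊥
eval nat       X k = ⊤
eval (sing n)  X k = k ≡ n
eval (a ∪c b)  X k = eval a X k ⊎ eval b X k
eval (a ∩c b)  X k = eval a X k × eval b X k
eval (compl a) X k = ¬ eval a X k
eval (a ⊕c b)  X k = (eval a X ⊕ eval b X) k
eval (a ⊗c b)  X k = (eval a X ⊗ eval b X) k

singleton : ℕ → SetN
singleton n k = k ≡ n

_≐_ : SetN → SetN → Set
s ≐ t = ∀ k → s k ⇔ t k

-- f is semi-regressive: for every ℓ there is n with n + ℓ ≤ f n ≤ 2n - 2.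
-- The upper bound f n ≤ 2n - 2 (over ℤ) is written f n + 2 ≤ 2 * n to avoid
-- truncated subtraction.
SemiRegressive : (ℕ → ℕ) → Set
SemiRegressive f = ∀ (ℓ : ℕ) → ∃ λ (n : ℕ) → (n + ℓ ≤ f n) × (f n + 2 ≤ 2 * n)

module Submission where

-- The circuit is  τ(x) = firstGap (below(x) ⊕ (below(x) ∩ evens)),  where
--   below(x)   = ∁(x ⊕ ℕ)            maps {n} to the initial segment [0, n),
--   evens      = {2} ⊗ ℕ,
--   firstGap c = ∁c ∩ ∁(∁c ⊕ ({1} ⊕ ℕ)) picks the least element outside c.
-- On input {n} with n = m + 1 the inner sumset is
--   { a + 2c | a ≤ m, 2c ≤ m } = [0, m + 2⌊m/2⌋]
-- (every k up to that bound splits as a + 2c by peeling off 2's), and it is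
-- empty for n = 0.  Hence τ({n}) = {f n} with  f n = n + 2⌊(n-1)/2⌋.
-- For n = 2l + 2 this gives f n = n + 2l = 2n - 2, so f is semi-regressive.
-- The file first proves the behaviour of each building block (below,
-- strictlyAbove, firstGap), then the arithmetic facts about halving and
-- sums a + 2c, then computes the sumset, and finally assembles theorem9.

open import Defs
open import Data.Nat using (ℕ; zero; suc; pred; _+_; _*_; _∸_; _≤_; _<_; z≤n; s≤s; ⌊_/2⌋; ⌈_/2⌉; _<?_)
open import Data.Nat.Properties
open import Data.Nat.Tactic.RingSolver using (solve-∀)
open import Data.Product using (Σ; ∃; _×_; _,_)
open import Data.Empty using (⊥-elim)
open import Data.Unit using (tt)
open import Relation.Nullary using (yes; no)
open import Relation.Binary.PropositionalEquality
open import Function.Bundles using (_⇔_; mk⇔; Equivalence)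

open Equivalence using (to; from)

initialSegment : ℕ → SetN
initialSegment m k = k < m

finalSegment : ℕ → SetN
finalSegment m k = m ≤ k

below : Circuit
below = compl (var ⊕c nat)

evens : Circuit
evens = sing 2 ⊗c nat

strictlyAbove : Circuit → Circuit
strictlyAbove d = d ⊕c (sing 1 ⊕c nat)

-- The least element not in c: outside c, and not strictly above any
-- element outside c.
firstGap : Circuit → Circuit
firstGap c = compl c ∩c compl (strictlyAbove (compl c))

below-correct : ∀ n → eval below (singleton n) ≐ initialSegment n
below-correct n k = mk⇔ to′ from′
  where
  to′ : eval below (singleton n) k → k < n
  to′ k∉n+ℕ with k <? n
  ... | yes k<n = k<n
  ... | no  k≮n = ⊥-elim (k∉n+ℕ (n , _ , refl , tt , sym (m+[n∸m]≡n (≮⇒≥ k≮n))))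
  from′ : k < n → eval below (singleton n) k
  from′ k<n (.n , j , refl , _ , k≡n+j) = <⇒≱ k<n (subst (n ≤_) (sym k≡n+j) (m≤m+n n j))

compl-initialSegment : ∀ c X m → eval c X ≐ initialSegment m →
                       eval (compl c) X ≐ finalSegment m
compl-initialSegment c X m c≐<m k =
  mk⇔ (λ k∉c → ≮⇒≥ (λ k<m → k∉c (from (c≐<m k) k<m)))
      (λ m≤k k∈c → ≤⇒≯ m≤k (to (c≐<m k) k∈c))

strictlyAbove-finalSegment : ∀ d X m → eval d X ≐ finalSegment m →
                             eval (strictlyAbove d) X ≐ finalSegment (suc m)
strictlyAbove-finalSegment d X m d≐≥m k = mk⇔ to′ from′
  where
  to′ : eval (strictlyAbove d) X k → m < k
  to′ (x , .(suc v) , x∈d , (.1 , v , refl , _ , refl) , refl) =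
    subst (m <_) (sym (+-suc x v)) (s≤s (≤-trans (to (d≐≥m x) x∈d) (m≤m+n x v)))
  from′ : m < k → eval (strictlyAbove d) X k
  from′ m<k = m , suc (k ∸ suc m) , from (d≐≥m m) ≤-refl , (1 , k ∸ suc m , refl , tt , refl) ,
              trans (sym (m+[n∸m]≡n m<k)) (sym (+-suc m (k ∸ suc m)))

firstGap-correct : ∀ c X m → eval c X ≐ initialSegment m →
                   eval (firstGap c) X ≐ singleton m
firstGap-correct c X m c≐<m k =
  mk⇔ (λ (k∉c , k≯gap) → ≤-antisym (≮⇒≥ (λ m<k → k≯gap (from (above k) m<k))) (to (outside k) k∉c))
      (λ { refl → from (outside k) ≤-refl , λ k>gap → <-irrefl refl (to (above k) k>gap) })
  where
  outside : eval (compl c) X ≐ finalSegment m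
  outside = compl-initialSegment c X m c≐<m
  above : eval (strictlyAbove (compl c)) X ≐ finalSegment (suc m)
  above = strictlyAbove-finalSegment (compl c) X m outside

double≤⇔≤half : ∀ c m → 2 * c ≤ m ⇔ c ≤ ⌊ m /2⌋
double≤⇔≤half c m = mk⇔ to′ from′
  where
  double≡c+c : 2 * c ≡ c + c
  double≡c+c = cong (c +_) (+-identityʳ c)
  to′ : 2 * c ≤ m → c ≤ ⌊ m /2⌋
  to′ 2c≤m = subst (_≤ ⌊ m /2⌋) (sym (n≡⌊n+n/2⌋ c))
                   (⌊n/2⌋-mono (subst (_≤ m) double≡c+c 2c≤m))
  from′ : c ≤ ⌊ m /2⌋ → 2 * c ≤ m
  from′ c≤m/2 = begin
    2 * c               ≤⟨ *-monoʳ-≤ 2 c≤m/2 ⟩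
    2 * ⌊ m /2⌋         ≡⟨ cong (⌊ m /2⌋ +_) (+-identityʳ ⌊ m /2⌋) ⟩
    ⌊ m /2⌋ + ⌊ m /2⌋   ≤⟨ +-monoʳ-≤ ⌊ m /2⌋ (⌊n/2⌋≤⌈n/2⌉ m) ⟩
    ⌊ m /2⌋ + ⌈ m /2⌉   ≡⟨ ⌊n/2⌋+⌈n/2⌉≡n m ⟩
    m                   ∎
    where
    open ≤-Reasoning

a+2[1+c] : ∀ a c → a + 2 * suc c ≡ suc (suc (a + 2 * c))
a+2[1+c] = solve-∀

-- Every k ≤ A + 2q splits as k = a + 2c with a ≤ A and c ≤ q, provided
-- q ≤ A: peel off 2's from k until either c reaches 0 or k drops below 2.
split-a+2c : ∀ A q k → q ≤ A → k ≤ A + 2 * q →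
             ∃ λ a → ∃ λ c → a ≤ A × c ≤ q × k ≡ a + 2 * c
split-a+2c A zero          k             _   k≤A   =
  k , 0 , subst (k ≤_) (+-identityʳ A) k≤A , z≤n , sym (+-identityʳ k)
split-a+2c A (suc q)       zero          _   _     = 0 , 0 , z≤n , z≤n , refl
split-a+2c A (suc q)       (suc zero)    q<A _     = 1 , 0 , ≤-trans (s≤s z≤n) q<A , z≤n , refl
split-a+2c A (suc q)       (suc (suc k)) q<A k+2≤ with
  split-a+2c A q k (≤-trans (n≤1+n q) q<A) (≤-pred (≤-pred (subst (suc (suc k) ≤_) (a+2[1+c] A q) k+2≤)))
... | a , c , a≤A , c≤q , k≡a+2c =
  a , suc c , a≤A , s≤s c≤q , trans (cong (λ x → suc (suc x)) k≡a+2c) (sym (a+2[1+c] a c))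

-- The function computed by τ: f n = n + 2⌊(n-1)/2⌋, i.e. one more than
-- the largest sum a + 2c with a < n and 2c < n (and f 0 = 0).
f : ℕ → ℕ
f n = n + 2 * ⌊ pred n /2⌋

sums : Circuit
sums = below ⊕c (below ∩c evens)

sums-correct : ∀ n → eval sums (singleton n) ≐ initialSegment (f n)
sums-correct zero k =
  mk⇔ (λ { (a , _ , a<0 , _) → ⊥-elim (n≮0 (to (below-correct 0 a) a<0)) }) λ ()
sums-correct (suc m) k = mk⇔ to′ from′
  where
  to′ : eval sums (singleton (suc m)) k → k < f (suc m)
  to′ (a , .(2 * c) , a∈below , (2c∈below , (.2 , c , refl , _ , refl)) , refl) =
    s≤s (+-mono-≤ (≤-pred (to (below-correct (suc m) a) a∈below))
                  (*-monoʳ-≤ 2 (to (double≤⇔≤half c m) (≤-pred (to (below-correct (suc m) (2 * c)) 2c∈below)))))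
  from′ : k < f (suc m) → eval sums (singleton (suc m)) k
  from′ k<fn with split-a+2c m ⌊ m /2⌋ k (⌊n/2⌋≤n m) (≤-pred k<fn)
  ... | a , c , a≤m , c≤m/2 , k≡a+2c =
    a , 2 * c , from (below-correct (suc m) a) (s≤s a≤m) ,
    (from (below-correct (suc m) (2 * c)) (s≤s (from (double≤⇔≤half c m) c≤m/2)) , (2 , c , refl , tt , refl)) ,
    k≡a+2c

⌊1+l+l/2⌋≡l : ∀ l → ⌊ suc (l + l) /2⌋ ≡ l
⌊1+l+l/2⌋≡l zero    = refl
⌊1+l+l/2⌋≡l (suc l) = cong suc (trans (cong ⌊_/2⌋ (+-suc l l)) (⌊1+l+l/2⌋≡l l))

f-even : ∀ l → f (suc (suc (l + l))) ≡ suc (suc (l + l)) + 2 * l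
f-even l = cong (λ h → suc (suc (l + l)) + 2 * h) (⌊1+l+l/2⌋≡l l)

f-semiRegressive : SemiRegressive f
f-semiRegressive l = n , lower , upper
  where
  n : ℕ
  n = suc (suc (l + l))
  lower : n + l ≤ f n
  lower = subst (n + l ≤_) (sym (f-even l)) (+-monoʳ-≤ n (m≤m+n l (l + 0)))
  f[n]+2≡2n : ∀ l → suc (suc (l + l)) + 2 * l + 2 ≡ 2 * suc (suc (l + l))
  f[n]+2≡2n = solve-∀
  upper : f n + 2 ≤ 2 * n
  upper = ≤-reflexive (trans (cong (_+ 2) (f-even l)) (f[n]+2≡2n l))

theorem9 : Σ Circuit λ τ → Σ (ℕ → ℕ) λ f →
             SemiRegressive f × (∀ (n : ℕ) → eval τ (singleton n) ≐ singleton (f n))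
theorem9 = firstGap sums , f , f-semiRegressive ,
           λ n → firstGap-correct sums (singleton n) (f n) (sums-correct n)
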